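{- Logical convergence does not in general imply convergence in the $n$-bisimulation topology. Precisely: there exist a countable set of atoms $\Phi$, a finite set of agents $I$, a normal modal logic $\Lambda$ over the language $\mathcal{L}$ built from $\Phi$ and $I$, an $\mathcal{L}_\Lambda$ modal space $\mathbf{X}$ (of a set $X$ of pointed Kripke models on which modal equivalence and bisimilarity coincide), a point $\mathbf{x}\in\mathbf{X}$ and a sequence $\mathbf{x}_1,\mathbf{x}_2,\dots$ in $\mathbf{X}$ such that $\mathbf{x}_1,\mathbf{x}_2,\dots$ logically converges to $\mathbf{x}$, but does not converge to $\mathbf{x}$ in the topological space $(\mathbf{X},\mathcal{T}_B)$.
   Context: Let $\Phi$ be a countable set of atoms and $I$ a finite set of agents. The language $\mathcal{L}$ is given by $\varphi ::= \top \mid p \mid \neg\varphi \mid \varphi\wedge\varphi \mid \Box_i\varphi$ with $p\in\Phi$, $i\in I$. A logic $\Lambda$ is any extension of the minimal normal modal logic $K$ over $\mathcal{L}$. A $\Lambda$-proposition $\boldsymbol{\varphi}$ is the set of formulas $\Lambda$-provably equivalent to $\varphi$; $\mathcal{L}_\Lambda$ is the set of all $\Lambda$-propositions. A Kripke model is $M=([\![M]\!],R,[\![\cdot]\!])$ with $[\![M]\!]$ a countable non-empty set of states, $R_i\subseteq [\![M]\!]^2$ for each $i\in I$, and a valuation $[\![\cdot]\!]:\Phi\to\mathcal{P}([\![M]\!])$; a pointed Kripke model is $Ms$ with $s\in[\![M]\!]$; satisfaction is standard, with $Ms\models\Box_i\varphi$ iff $Mt\models\varphi$ for all $t$ with $sR_it$.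 For a set $X$ of pointed Kripke models, its $\mathcal{L}_\Lambda$ modal space is $\mathbf{X}=\{\mathbf{x}: x\in X\}$ where $\mathbf{x}=\{y\in X: y\models\varphi \text{ iff } x\models\varphi \text{ for all }\boldsymbol{\varphi}\in\mathcal{L}_\Lambda\}$; we write $\mathbf{x}\models\varphi$ if $x\models\varphi$. A sequence $\mathbf{x}_1,\mathbf{x}_2,\dots$ in $\mathbf{X}$ logically converges to $\mathbf{x}\in\mathbf{X}$ iff for every $\boldsymbol{\varphi}\in\mathcal{L}_\Lambda$ with $x\models\varphi$ there is $N$ such that $x_n\models\varphi$ for all $n\ge N$. For $X$ on which modal equivalence and bisimilarity coincide, the $n$-bisimulation metric is $d_B(\mathbf{x},\mathbf{y})=0$ if $x$ and $y$ are $n$-bisimilar for all $n$, and $d_B(\mathbf{x},\mathbf{y})=2^{ -n}$ where $n$ is the least integer such that $x$ and $y$ are not $n$-bisimilar; $\mathcal{T}_B$ is the metric topology induced by $d_B$ on $\mathbf{X}$. -}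

module Defs where

open import Data.Nat using (ℕ; zero; suc; _≥_; _<_)
open import Data.Fin using (Fin)
open import Data.Bool using (Bool; true; false; not; _∧_)
open import Data.Product using (Σ; _×_; _,_; ∃)
open import Data.Sum using (_⊎_)
open import Relation.Nullary using (¬_)
open import Relation.Binary.PropositionalEquality using (_≡_)
open import Data.Rational as ℚ using (ℚ; 0ℚ; 1ℚ; ½)

_⇔_ : Set → Set → Set
A ⇔ B = (A → B) × (B → A)
infix 3 _⇔_

record Countable (A : Set) : Set where
  field
    enc : A → ℕ
    enc-injective : ∀ {a b} → enc a ≡ enc b → a ≡ b

data Form (Φ I : Set) : Set where
  ⊤ᶠ   : Form Φ I
  atom : Φ → Form Φ I
  ¬ᶠ_  : Form Φ I → Form Φ I
  _∧ᶠ_ : Form Φ I → Form Φ I → Form Φ I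
  □    : I → Form Φ I → Form Φ I

infix 8 ¬ᶠ_
infixr 7 _∧ᶠ_

module _ {Φ I : Set} where

  infixr 6 _⇒ᶠ_ _⇔ᶠ_
  _⇒ᶠ_ : Form Φ I → Form Φ I → Form Φ I
  φ ⇒ᶠ ψ = ¬ᶠ (φ ∧ᶠ ¬ᶠ ψ)

  _⇔ᶠ_ : Form Φ I → Form Φ I → Form Φ I
  φ ⇔ᶠ ψ = (φ ⇒ᶠ ψ) ∧ᶠ (ψ ⇒ᶠ φ)

  subst : (Φ → Form Φ I) → Form Φ I → Form Φ I
  subst σ ⊤ᶠ = ⊤ᶠ
  subst σ (atom p) = σ p
  subst σ (¬ᶠ φ) = ¬ᶠ subst σ φ
  subst σ (φ ∧ᶠ ψ) = subst σ φ ∧ᶠ subst σ ψ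
  subst σ (□ i φ) = □ i (subst σ φ)

  -- propositional evaluation: atoms and boxed formulas are treated as
  -- propositional variables (their values are read off v)
  peval : (Form Φ I → Bool) → Form Φ I → Bool
  peval v ⊤ᶠ = true
  peval v (atom p) = v (atom p)
  peval v (¬ᶠ φ) = not (peval v φ)
  peval v (φ ∧ᶠ ψ) = peval v φ ∧ peval v ψ
  peval v (□ i φ) = v (□ i φ)

  Tautology : Form Φ I → Set
  Tautology φ = ∀ (v : Form Φ I → Bool) → peval v φ ≡ true

  record NormalLogic (Λ : Form Φ I → Set) : Set where
    field
      taut : ∀ φ → Tautology φ → Λ φ
      axK  : ∀ i φ ψ → Λ (□ i (φ ⇒ᶠ ψ) ⇒ᶠ (□ i φ ⇒ᶠ □ i ψ))
      mp   : ∀ φ ψ → Λ φ → Λ (φ ⇒ᶠ ψ) → Λ ψ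
      nec  : ∀ i φ → Λ φ → Λ (□ i φ)
      us   : ∀ (σ : Φ → Form Φ I) φ → Λ φ → Λ (subst σ φ)

record Kripke (Φ I : Set) : Set₁ where
  field
    State     : Set
    countable : Countable State
    inhabited : State
    R         : I → State → State → Set
    V         : Φ → State → Set
open Kripke public

record Pointed (Φ I : Set) : Set₁ where
  constructor _,,_
  field
    model : Kripke Φ I
    point : State model
open Pointed public

module _ {Φ I : Set} where

  Sat : (M : Kripke Φ I) → State M → Form Φ I → Set
  Sat M s ⊤ᶠ = Data.Unit.⊤ where import Data.Unit
  Sat M s (atom p) = V M p s
  Sat M s (¬ᶠ φ) = ¬ Sat M s φ
  Sat M s (φ ∧ᶠ ψ) = Sat M s φ × Sat M s ψ
  Sat M s (□ i φ) = ∀ t → R M i s t → Sat M t φ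

  _⊨_ : Pointed Φ I → Form Φ I → Set
  x ⊨ φ = Sat (model x) (point x) φ
  infix 4 _⊨_

  -- modal equivalence w.r.t. L_Λ (x and y lie in the same point of the
  -- modal space): agreement on every Λ-proposition, i.e. on every formula
  -- (each Λ-proposition is represented by a formula)
  ModEq : Pointed Φ I → Pointed Φ I → Set
  ModEq x y = ∀ φ → (y ⊨ φ ⇔ x ⊨ φ)

  record IsBisimulation (M N : Kripke Φ I)
                        (Z : State M → State N → Set) : Set where
    field
      atoms : ∀ s t → Z s t → ∀ p → (V M p s ⇔ V N p t)
      forth : ∀ s t → Z s t → ∀ i s' → R M i s s' →
              Σ (State N) λ t' → R N i t t' × Z s' t'
      back  : ∀ s t → Z s t → ∀ i t' → R N i t t' →
              Σ (State M) λ s' → R M i s s' × Z s' t'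

  Bisimilar : Pointed Φ I → Pointed Φ I → Set₁
  Bisimilar x y = Σ (State (model x) → State (model y) → Set) λ Z →
                    IsBisimulation (model x) (model y) Z × Z (point x) (point y)

  NBisim : ℕ → (M N : Kripke Φ I) → State M → State N → Set
  NBisim zero M N s t = ∀ p → (V M p s ⇔ V N p t)
  NBisim (suc n) M N s t =
    (∀ p → (V M p s ⇔ V N p t)) ×
    (∀ i s' → R M i s s' → Σ (State N) λ t' → R N i t t' × NBisim n M N s' t') ×
    (∀ i t' → R N i t t' → Σ (State M) λ s' → R M i s s' × NBisim n M N s' t')

  _≈[_]_ : Pointed Φ I → ℕ → Pointed Φ I → Set
  x ≈[ n ] y = NBisim n (model x) (model y) (point x) (point y)

-- The n-bisimulation metric, as the relation  d_B(x , y) ≡ r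

half^ : ℕ → ℚ
half^ zero = 1ℚ
half^ (suc n) = ½ ℚ.* half^ n

module _ {Φ I : Set} where

  DistB : Pointed Φ I → Pointed Φ I → ℚ → Set
  DistB x y r =
      (r ≡ 0ℚ × (∀ n → x ≈[ n ] y))
    ⊎ (Σ ℕ λ n → r ≡ half^ n × ¬ (x ≈[ n ] y) × (∀ m → m < n → x ≈[ m ] y))

  ConvergesB : (ℕ → Pointed Φ I) → Pointed Φ I → Set
  ConvergesB xs x = ∀ (ε : ℚ) → 0ℚ ℚ.< ε →
    Σ ℕ λ N → ∀ n → n ≥ N → ∀ r → DistB (xs n) x r → r ℚ.< ε

  LogConverges : (ℕ → Pointed Φ I) → Pointed Φ I → Set
  LogConverges xs x = ∀ φ → x ⊨ φ → Σ ℕ λ N → ∀ n → n ≥ N → xs n ⊨ φ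

  -- X is a set of pointed models suitable as an L_Λ modal space:
  -- satisfaction of Λ-propositions is well defined on X (Λ-provably
  -- equivalent formulas agree on every member of X), and modal
  -- equivalence and bisimilarity coincide on X.
  record ModalSpace (Λ : Form Φ I → Set) (X : Pointed Φ I → Set) : Set₁ where
    field
      wellDefined : ∀ x → X x → ∀ φ ψ → Λ (φ ⇔ᶠ ψ) → (x ⊨ φ ⇔ x ⊨ ψ)
      modEq⇔bisim : ∀ x y → X x → X y →
                    (ModEq x y → Bisimilar x y) × (Bisimilar x y → ModEq x y)

-- With no agents the language is propositional, and Λ can be taken to be the
-- classical tautologies. Let x make every atom true and xₙ make exactly
-- p₀, …, pₙ₋₁ true. A formula mentions only finitely many atoms, so it is
-- eventually evaluated identically at xₙ and at x: the xₙ converge logically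
-- to x. But xₙ and x already disagree on the atom pₙ, so they are not even
-- 0-bisimilar and d_B(xₙ, x) = 1 for every n.
module Submission where

open import Defs
open import Data.Bool using (Bool; true; false; not; _∧_; T)
open import Data.Fin using (Fin)
open import Data.Nat using (ℕ; suc; _<_; _⊔_; _<ᵇ_)
open import Data.Nat.Properties using (≤-refl; ≤-trans; <-irrefl; m≤m⊔n; m≤n⊔m; <ᵇ⇒<; <⇒<ᵇ)
open import Data.Product using (Σ; _×_; _,_; proj₁; proj₂; map)
open import Data.Rational as ℚ using (0ℚ; 1ℚ; ½)
open import Data.Rational.Properties using (<-asym)
open import Data.Sum using (inj₂)
open import Data.Unit using (⊤; tt)
open import Function using (id; _∘_; const)
open import Relation.Binary.PropositionalEquality as ≡ using (_≡_; refl; sym; trans; cong; cong₂)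
open import Relation.Nullary using (¬_)
open import Relation.Nullary.Decidable using (toWitness)

⇔-refl : ∀ {A} → A ⇔ A
⇔-refl = id , id

⇔-sym : ∀ {A B} → A ⇔ B → B ⇔ A
⇔-sym (f , g) = g , f

⇔-trans : ∀ {A B C} → A ⇔ B → B ⇔ C → A ⇔ C
⇔-trans (f , g) (f′ , g′) = f′ ∘ f , g ∘ g′

¬-cong-⇔ : ∀ {A B} → A ⇔ B → (¬ A) ⇔ (¬ B)
¬-cong-⇔ (f , g) = (λ ¬a → ¬a ∘ g) , (λ ¬b → ¬b ∘ f)

×-cong-⇔ : ∀ {A B C D} → A ⇔ B → C ⇔ D → (A × C) ⇔ (B × D)
×-cong-⇔ (f , g) (f′ , g′) = map f f′ , map g g′

¬-⇔-T-not : ∀ {A} b → A ⇔ T b → (¬ A) ⇔ T (not b)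
¬-⇔-T-not true  (f , g) = (λ ¬a → ¬a (g tt)) , λ ()
¬-⇔-T-not false (f , g) = const tt , λ _ → f

×-⇔-T-∧ : ∀ {A B} a b → A ⇔ T a → B ⇔ T b → (A × B) ⇔ T (a ∧ b)
×-⇔-T-∧ true  b (_ , g) (f′ , g′) = f′ ∘ proj₂ , λ tb → g tt , g′ tb
×-⇔-T-∧ false b (f , _) _         = f ∘ proj₁ , λ ()

T-modusPonens : ∀ a b → T a → T (not (a ∧ not b)) → T b
T-modusPonens true true  _ _ = tt
T-modusPonens true false _ ()

T-biimplication : ∀ a b → T (not (a ∧ not b) ∧ not (b ∧ not a)) → a ≡ b
T-biimplication true  true  _ = refl
T-biimplication false false _ = refl

module _ {Φ : Set} where

  eval : (Φ → Bool) → Form Φ (Fin 0) → Bool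
  eval w ⊤ᶠ       = true
  eval w (atom p) = w p
  eval w (¬ᶠ φ)   = not (eval w φ)
  eval w (φ ∧ᶠ ψ) = eval w φ ∧ eval w ψ
  eval w (□ () φ)

  Valid : Form Φ (Fin 0) → Set
  Valid φ = ∀ w → T (eval w φ)

  atomsBy : (Φ → Bool) → Form Φ (Fin 0) → Bool
  atomsBy w (atom p) = w p
  atomsBy w _        = true

  peval-atomsBy : ∀ w φ → peval (atomsBy w) φ ≡ eval w φ
  peval-atomsBy w ⊤ᶠ       = refl
  peval-atomsBy w (atom p) = refl
  peval-atomsBy w (¬ᶠ φ)   = cong not (peval-atomsBy w φ)
  peval-atomsBy w (φ ∧ᶠ ψ) = cong₂ _∧_ (peval-atomsBy w φ) (peval-atomsBy w ψ)
  peval-atomsBy w (□ () φ)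

  eval-subst : ∀ w σ φ → eval w (subst σ φ) ≡ eval (eval w ∘ σ) φ
  eval-subst w σ ⊤ᶠ       = refl
  eval-subst w σ (atom p) = refl
  eval-subst w σ (¬ᶠ φ)   = cong not (eval-subst w σ φ)
  eval-subst w σ (φ ∧ᶠ ψ) = cong₂ _∧_ (eval-subst w σ φ) (eval-subst w σ ψ)
  eval-subst w σ (□ () φ)

  Valid-normal : NormalLogic Valid
  Valid-normal = record
    { taut = λ φ taut w → ≡.subst T (trans (sym (taut (atomsBy w))) (peval-atomsBy w φ)) tt
    ; axK  = λ ()
    ; mp   = λ φ ψ ⊢φ ⊢φ⇒ψ w → T-modusPonens (eval w φ) (eval w ψ) (⊢φ w) (⊢φ⇒ψ w)
    ; nec  = λ ()
    ; us   = λ σ φ ⊢φ w → ≡.subst T (sym (eval-subst w σ φ)) (⊢φ (eval w ∘ σ))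
    }

  Sat⇔eval : ∀ {M s} w → (∀ p → V M p s ⇔ T (w p)) → ∀ φ → Sat M s φ ⇔ T (eval w φ)
  Sat⇔eval w atoms ⊤ᶠ       = ⇔-refl
  Sat⇔eval w atoms (atom p) = atoms p
  Sat⇔eval w atoms (¬ᶠ φ)   = ¬-⇔-T-not (eval w φ) (Sat⇔eval w atoms φ)
  Sat⇔eval w atoms (φ ∧ᶠ ψ) =
    ×-⇔-T-∧ (eval w φ) (eval w ψ) (Sat⇔eval w atoms φ) (Sat⇔eval w atoms ψ)
  Sat⇔eval w atoms (□ () φ)

  -- Constructively a tautology holds at a point only if its atoms are decided
  -- there; the modal space consists of exactly such points.
  AtomsDecided : Pointed Φ (Fin 0) → Set
  AtomsDecided x = Σ (Φ → Bool) λ w → ∀ p → x ⊨ atom p ⇔ T (w p)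

  Valid-sound : ∀ {x} → AtomsDecided x → ∀ φ ψ → Valid (φ ⇔ᶠ ψ) → x ⊨ φ ⇔ x ⊨ ψ
  Valid-sound {x} (w , atoms) φ ψ ⊢φ⇔ψ =
    ⇔-trans (Sat⇔eval w atoms φ)
      (≡.subst (λ b → T b ⇔ x ⊨ ψ) (sym (T-biimplication _ _ (⊢φ⇔ψ w)))
        (⇔-sym (Sat⇔eval w atoms ψ)))

atomBound : Form ℕ (Fin 0) → ℕ
atomBound ⊤ᶠ       = 0
atomBound (atom p) = suc p
atomBound (¬ᶠ φ)   = atomBound φ
atomBound (φ ∧ᶠ ψ) = atomBound φ ⊔ atomBound ψ
atomBound (□ () φ)

AtomsAgreeBelow : ℕ → (M N : Kripke ℕ (Fin 0)) → State M → State N → Set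
AtomsAgreeBelow n M N s t = ∀ p → p < n → V M p s ⇔ V N p t

Sat-cong-atoms : ∀ {M N s t} φ → AtomsAgreeBelow (atomBound φ) M N s t →
                 Sat M s φ ⇔ Sat N t φ
Sat-cong-atoms ⊤ᶠ       agree = ⇔-refl
Sat-cong-atoms (atom p) agree = agree p ≤-refl
Sat-cong-atoms (¬ᶠ φ)   agree = ¬-cong-⇔ (Sat-cong-atoms φ agree)
Sat-cong-atoms (φ ∧ᶠ ψ) agree =
  ×-cong-⇔ (Sat-cong-atoms φ λ p p< → agree p (≤-trans p< (m≤m⊔n _ (atomBound ψ))))
           (Sat-cong-atoms ψ λ p p< → agree p (≤-trans p< (m≤n⊔m (atomBound φ) _)))
Sat-cong-atoms (□ () φ) agree

AtomsAgree : (M N : Kripke ℕ (Fin 0)) → State M → State N → Set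
AtomsAgree M N s t = ∀ p → V M p s ⇔ V N p t

-- Without agents there are no transitions, so agreement on atoms is a bisimulation.
AtomsAgree-isBisimulation : ∀ M N → IsBisimulation M N (AtomsAgree M N)
AtomsAgree-isBisimulation M N = record
  { atoms = λ _ _ agree → agree
  ; forth = λ _ _ _ ()
  ; back  = λ _ _ _ ()
  }

ModEq⇒Bisimilar : ∀ x y → ModEq x y → Bisimilar x y
ModEq⇒Bisimilar x y x≡y = AtomsAgree (model x) (model y)
  , AtomsAgree-isBisimulation (model x) (model y)
  , λ p → ⇔-sym (x≡y (atom p))

Bisimilar⇒ModEq : ∀ x y → Bisimilar x y → ModEq x y
Bisimilar⇒ModEq x y (Z , isBisim , xZy) φ =
  ⇔-sym (Sat-cong-atoms φ λ p _ → IsBisimulation.atoms isBisim _ _ xZy p)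

AtomsDecided-modalSpace : ModalSpace Valid AtomsDecided
AtomsDecided-modalSpace = record
  { wellDefined = λ _ decided → Valid-sound decided
  ; modEq⇔bisim = λ x y _ _ → ModEq⇒Bisimilar x y , Bisimilar⇒ModEq x y
  }

singleton : (ℕ → Bool) → Pointed ℕ (Fin 0)
singleton w = record
  { State     = ⊤
  ; countable = record { enc = const 0 ; enc-injective = const refl }
  ; inhabited = tt
  ; R         = λ ()
  ; V         = λ p _ → T (w p)
  } ,, tt

singleton-atomsDecided : ∀ w → AtomsDecided (singleton w)
singleton-atomsDecided w = w , λ _ → ⇔-refl

allTrue : Pointed ℕ (Fin 0)
allTrue = singleton (const true)

trueBelow : ℕ → Pointed ℕ (Fin 0)
trueBelow n = singleton (_<ᵇ n)

trueBelow-logConverges : LogConverges trueBelow allTrue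
trueBelow-logConverges φ allTrue⊨φ = atomBound φ , λ n n≥ →
  proj₁ (Sat-cong-atoms φ λ p p< → (λ _ → <⇒<ᵇ (≤-trans p< n≥)) , const tt) allTrue⊨φ

trueBelow-not-0-bisimilar : ∀ n → ¬ (trueBelow n ≈[ 0 ] allTrue)
trueBelow-not-0-bisimilar n 0-bisim = <-irrefl refl (<ᵇ⇒< n n (proj₂ (0-bisim n) tt))

trueBelow-distance-1 : ∀ n → DistB (trueBelow n) allTrue 1ℚ
trueBelow-distance-1 n = inj₂ (0 , refl , trueBelow-not-0-bisimilar n , λ _ ())

trueBelow-not-convergesB : ¬ ConvergesB trueBelow allTrue
trueBelow-not-convergesB converges with converges ½ (toWitness {a? = 0ℚ ℚ.<? ½} tt)
... | N , close = <-asym (toWitness {a? = ½ ℚ.<? 1ℚ} tt)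
                         (close N ≤-refl 1ℚ (trueBelow-distance-1 N))

proposition1 :
    Σ Set λ Φ → Countable Φ × Σ ℕ λ k →
    Σ (Form Φ (Fin k) → Set) λ Λ → NormalLogic Λ ×
    Σ (Pointed Φ (Fin k) → Set) λ X → ModalSpace Λ X ×
    Σ (Pointed Φ (Fin k)) λ x → X x ×
    Σ (ℕ → Pointed Φ (Fin k)) λ xs → (∀ n → X (xs n)) ×
    LogConverges xs x × ¬ ConvergesB xs x
proposition1 =
  ℕ , record { enc = id ; enc-injective = id } , 0 ,
  Valid , Valid-normal ,
  AtomsDecided , AtomsDecided-modalSpace ,
  allTrue , singleton-atomsDecided (const true) ,
  trueBelow , (λ n → singleton-atomsDecided (_<ᵇ n)) ,
  trueBelow-logConverges , trueBelow-not-convergesB
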